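{- Let $b\ge 2$ be an integer and let $n>0$ be an integer with base-$b$ digits $n=(n_{N-1}\cdots n_0)_b$, where $N$ is the maximum of the number of base-$b$ digits of $n$ and of $|k|$, for a given integer $k$. Let $\mathbf{b}_N=\{1,b,\dots,b^{N-1}\}$. For a positive integer $m$, let $\mathcal{P}_n(m,\mathbf{b}_N)$ be the set of $N$-tuples $(j_{N-1},\dots,j_0)$ of nonnegative integers with $\sum_{l=0}^{N-1}j_lb^l=m$ (with $\mathcal{P}_n(0,\mathbf{b}_N)=\{(0,\dots,0)\}$), and let $\mathcal{P}^*_n(m,\mathbf{b}_N)$ be the subset of those tuples satisfying additionally $j_l\ge n_l$ for all $l=0,\dots,N-1$. Then \[ \binom{ -n}{k}_b=\begin{cases}\displaystyle\sum_{(j_{N-1},\dots,j_0)\in\mathcal{P}_n(k,\mathbf{b}_N)}\prod_{l=0}^{N-1}\binom{ -n_l}{j_l}, & \text{if } k\ge 0,\\[2ex] \displaystyle\sum_{(j_{N-1},\dots,j_0)\in\mathcal{P}^*_n(-k,\mathbf{b}_N)}\prod_{l=0}^{N-1}\binom{ -n_l}{ -j_l}, & \text{if } k<0.\end{cases} \]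
   Context: Fix an integer base $b\ge2$. Every integer $m\ge0$ has base-$b$ digits $m_l\in\{0,\dots,b-1\}$ with $m=\sum_{l\ge0}m_lb^l$. By convention, for $m>0$ the digits of $-m$ are $-m_l$ (all nonpositive). For $m\in\mathbb Z$ with digits $m_l$, put $f_{m,b}(x)=\prod_{l\ge0}(1+x^{b^l})^{m_l}$. The $b$-ary binomial coefficient $\binom{m}{k}_b$ ($m,k\in\mathbb Z$) is defined as: if $m\ge0$, the coefficient of $x^k$ in the polynomial $f_{m,b}(x)$ (zero for $k<0$); if $m<0$ and $k\ge0$, the coefficient of $x^k$ in the power series expansion of $f_{m,b}(x)$ about $x=0$; if $m<0$ and $k<0$, the coefficient of $x^k$ in the expansion of $f_{m,b}(x)$ as a power series in $1/x$. The ordinary binomial coefficient $\binom{a}{j}$ for $a,j\in\mathbb Z$ is the coefficient of $x^j$ in $(1+x)^a$, understood in the same way: for $a\ge0$ the polynomial (so $0$ if $j<0$ or $j>a$); for $a<0,j\ge0$ the expansion about $0$, so $\binom{a}{j}=(-1)^j\binom{ -a+j-1}{j}$; for $a<0,j<0$ the expansion in powers of $1/x$. -}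

module Defs where

open import Data.Bool using (Bool; true; false; _∧_; if_then_else_)
open import Data.Nat as ℕ using (ℕ; zero; suc; _∸_; _^_; _/_; _%_; _≡ᵇ_; _≤ᵇ_)
open import Data.Integer as ℤ using (ℤ; +_; -[1+_])
open import Data.List as List using (List; []; _∷_; _++_; [_]; length; reverse; map; concatMap; upTo; filterᵇ; foldr; replicate)
open import Data.Vec as Vec using (Vec; lookup)
open import Data.Fin as Fin using (Fin; toℕ)

-- Polynomials with integer coefficients: coefficient lists, ascending.

Poly : Set
Poly = List ℤ

coeff : Poly → ℕ → ℤ
coeff []       _       = + 0
coeff (a ∷ _)  zero    = a
coeff (_ ∷ p)  (suc i) = coeff p i

addP : Poly → Poly → Poly
addP []       q        = q
addP p        []       = p
addP (a ∷ p)  (c ∷ q)  = (a ℤ.+ c) ∷ addP p q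

scaleP : ℤ → Poly → Poly
scaleP a = map (a ℤ.*_)

mulP : Poly → Poly → Poly
mulP []      q = []
mulP (a ∷ p) q = addP (scaleP a q) (+ 0 ∷ mulP p q)

powP : Poly → ℕ → Poly
powP p zero    = [ + 1 ]
powP p (suc e) = mulP p (powP p e)

onePlusXPow : ℕ → Poly
onePlusXPow c = addP [ + 1 ] (replicate c (+ 0) ++ [ + 1 ])

dropZeros : Poly → Poly
dropZeros []            = []
dropZeros (+ zero ∷ p)  = dropZeros p
dropZeros p             = p

trim : Poly → Poly
trim p = reverse (dropZeros (reverse p))

-- Power series expansion about x = 0 of 1/P, for P with P(0) = 1:
-- c_0 = 1, c_k = - Σ_{i=1}^{k} P_i c_{k-i}.

sumZ : List ℤ → ℤ
sumZ = foldr ℤ._+_ (+ 0)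

invList : Poly → ℕ → List ℤ
invList p zero    = [ + 1 ]
invList p (suc k) =
  let cs = invList p k in
  cs ++ [ ℤ.- sumZ (map (λ i → coeff p (suc i) ℤ.* coeff cs (k ∸ i)) (upTo (suc k))) ]

invCoeff : Poly → ℕ → ℤ
invCoeff p k = coeff (invList p k) k

expandPos : Poly → ℤ → ℤ
expandPos p (+ k)     = coeff p k
expandPos p -[1+ _ ]  = + 0

-- Coefficient of x^k in the expansion of 1/P, where P has constant term 1
-- and leading coefficient 1:
--  * k ≥ 0 : power series about x = 0;
--  * k < 0 : power series in 1/x.  Writing P(x) = x^d Q(1/x) with
--    d = deg P and Q the reversed polynomial (Q(0) = 1), one has
--    1/P(x) = x^(-d) · (1/Q)(1/x), so the coefficient of x^k is the
--    coefficient of y^(-k-d) in the series 1/Q(y) (zero if -k < d).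
expandNeg : Poly → ℤ → ℤ
expandNeg p (+ k)      = invCoeff p k
expandNeg p -[1+ t ]   =
  let p' = trim p
      d  = length p' ∸ 1
      q  = reverse p'
  in if d ≤ᵇ suc t then invCoeff q (suc t ∸ d) else + 0

digit : ℕ → ℕ → ℕ → ℕ
digit zero          m l       = 0
digit (suc b)       m zero    = m % suc b
digit (suc b)       m (suc l) = digit (suc b) (m / suc b) l

-- number of base-b digits of m (with 0 having 0 digits); fuel-based.
ndigitsF : ℕ → ℕ → ℕ → ℕ
ndigitsF zero     b               m       = 0
ndigitsF (suc f)  b               zero    = 0
ndigitsF (suc f)  (suc (suc c))   (suc m) = suc (ndigitsF f (suc (suc c)) (suc m / suc (suc c)))
ndigitsF (suc f)  _               (suc m) = 0

ndigits : ℕ → ℕ → ℕ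
ndigits b m = ndigitsF m b m

prodPoly : ℕ → (ℕ → Poly) → Poly
prodPoly zero    g = [ + 1 ]
prodPoly (suc L) g = mulP (prodPoly L g) (g L)

fpoly : ℕ → ℕ → Poly
fpoly b m = prodPoly (ndigits b m) (λ l → powP (onePlusXPow (b ^ l)) (digit b m l))

-- b-ary binomial coefficient.  For m < 0 the digits of m are -|m|_l, so
-- f_{m,b} = 1 / f_{|m|,b}.
bbinom : ℕ → ℤ → ℤ → ℤ
bbinom b (+ m)      k = expandPos (fpoly b m) k
bbinom b -[1+ m' ]  k = expandNeg (fpoly b (suc m')) k

binomZ : ℤ → ℤ → ℤ
binomZ (+ a)      j = expandPos (powP (+ 1 ∷ + 1 ∷ []) a) j
binomZ -[1+ a' ]  j = expandNeg (powP (+ 1 ∷ + 1 ∷ []) (suc a')) j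

allVecs : (N B : ℕ) → List (Vec ℕ N)
allVecs zero    B = [ Vec.[] ]
allVecs (suc N) B = concatMap (λ x → map (x Vec.∷_) (allVecs N B)) (upTo (suc B))

sumFinℕ : (N : ℕ) → (Fin N → ℕ) → ℕ
sumFinℕ zero    f = 0
sumFinℕ (suc N) f = f Fin.zero ℕ.+ sumFinℕ N (λ i → f (Fin.suc i))

prodFinℤ : (N : ℕ) → (Fin N → ℤ) → ℤ
prodFinℤ zero    f = + 1
prodFinℤ (suc N) f = f Fin.zero ℤ.* prodFinℤ N (λ i → f (Fin.suc i))

allFinᵇ : (N : ℕ) → (Fin N → Bool) → Bool
allFinᵇ zero    f = true
allFinᵇ (suc N) f = f Fin.zero ∧ allFinᵇ N (λ i → f (Fin.suc i))

-- Σ_l j_l b^l, with the entry at position l (index l : Fin N) being j_l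
weight : (b N : ℕ) → Vec ℕ N → ℕ
weight b N v = sumFinℕ N (λ l → lookup v l ℕ.* b ^ toℕ l)

-- P_n(m, b_N): N-tuples of nonnegative integers with Σ j_l b^l = m
-- (entries are necessarily ≤ m, so enumerating {0..m}^N is exhaustive).
Ptuples : (b N m : ℕ) → List (Vec ℕ N)
Ptuples b N m = filterᵇ (λ v → weight b N v ≡ᵇ m) (allVecs N m)

Pstar : (b n N m : ℕ) → List (Vec ℕ N)
Pstar b n N m = filterᵇ (λ v → allFinᵇ N (λ l → digit b n (toℕ l) ≤ᵇ lookup v l)) (Ptuples b N m)

sumOver : {A : Set} → List A → (A → ℤ) → ℤ
sumOver xs f = sumZ (map f xs)

-- With f = f_{n,b} = Π_l (1 + x^{b^l})^{n_l} and
-- formal power series over ℤ (coefficient sequences ℕ → ℤ):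
--   * the recursion defining invCoeff computes the inverse series 1/f;
--   * x ↦ x^b is a ring homomorphism, so f = Π_{l<N} (1+x)^{n_l}(x^{b^l}) and
--     1/f = Π_{l<N} C_l(x^{b^l}) with C_l = Σ_j binomZ(-n_l, j) x^j;
--   * the coefficient of x^m in Π_{l<N} c_l(x^{b^l}) is the sum of Π_l c_l(j_l)
--     over the tuples with Σ j_l b^l = m, which settles k ≥ 0;
--   * f is palindromic of degree n, so the expansion of 1/f in powers of 1/x is
--     x^{-n} times its expansion about 0; distributing x^n = Π_l x^{n_l b^l} over
--     the factors, with binomZ(-a, -j) the coefficient of x^j in x^a/(1+x)^a,
--     gives the sum over P*_n for k < 0.
-- General facts on series, polynomials, stretching and palindromes come first,
-- the base-b digit arguments live in the module Digits, the proposition last.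
module Submission where

open import Data.Nat as ℕ
  using (ℕ; zero; suc; _≤_; _<_; z≤n; s≤s; _∸_; _^_; _≡ᵇ_; _≤ᵇ_; _<ᵇ_; _/_; _%_; _⊔_)
import Data.Nat.Tactic.RingSolver as ℕSolver
open import Data.Nat.Induction using (<-rec)
open import Data.Product using (Σ; _,_; proj₁; proj₂; _×_)
import Data.Nat.Properties as ℕP
open import Data.Nat.DivMod using (m≡m%n+[m/n]*n; m%n<n; m/n<m; m<n*o⇒m/o<n)
open import Data.Integer as ℤ using (ℤ; +_; -_; -[1+_]; ∣_∣)
import Data.Integer.Properties as ℤP
open import Data.Integer.Tactic.RingSolver using (solve-∀)
open import Data.List as List
  using (List; []; _∷_; _++_; [_]; length; map; upTo; applyUpTo; replicate; concatMap; filterᵇ; reverse)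
import Data.List.Properties as LP
open import Relation.Binary.PropositionalEquality hiding ([_])
open import Relation.Nullary using (yes; no)
open import Data.Bool using (Bool; true; false; if_then_else_; T)
open import Data.Unit using (tt)
open import Data.Fin as Fin using (Fin; toℕ)
open import Data.Vec as Vec using (Vec; lookup)
open import Data.Maybe as Maybe using (Maybe; just; nothing)

open import Defs

-- Formal power series over ℤ, as coefficient sequences; equality of series
-- is pointwise equality _≗_.
Series : Set
Series = ℕ → ℤ

δ : Series
δ zero    = + 1
δ (suc _) = + 0

tail : Series → Series
tail s i = s (suc i)

shift : ℕ → Series → Series
shift zero    s i       = s i
shift (suc k) s zero    = + 0
shift (suc k) s (suc i) = shift k s i

infixl 6 _⊕_
infixl 7 _⊙_ _⊛_

_⊕_ : Series → Series → Series
(s ⊕ t) i = s i ℤ.+ t i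

_⊙_ : ℤ → Series → Series
(a ⊙ s) i = a ℤ.* s i

-- Cauchy product, by recursion on the index: (s t)_{n+1} = s₀ t_{n+1} + ((tail s) t)_n.
_⊛_ : Series → Series → Series
(s ⊛ t) zero    = s 0 ℤ.* t 0
(s ⊛ t) (suc n) = s 0 ℤ.* t (suc n) ℤ.+ (tail s ⊛ t) n

powS : Series → ℕ → Series
powS s zero    = δ
powS s (suc e) = s ⊛ powS s e

⊛-cong : ∀ {s s' t t'} → s ≗ s' → t ≗ t' → s ⊛ t ≗ s' ⊛ t'
⊛-cong p q zero    = cong₂ ℤ._*_ (p 0) (q 0)
⊛-cong p q (suc n) = cong₂ ℤ._+_ (cong₂ ℤ._*_ (p 0) (q (suc n))) (⊛-cong (λ i → p (suc i)) q n)

powS-cong : ∀ {s t} → s ≗ t → ∀ e → powS s e ≗ powS t e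
powS-cong p zero    i = refl
powS-cong p (suc e) = ⊛-cong p (powS-cong p e)

shift-cong : ∀ k {s t} → s ≗ t → shift k s ≗ shift k t
shift-cong zero    h i       = h i
shift-cong (suc k) h zero    = refl
shift-cong (suc k) h (suc i) = shift-cong k h i

shift-+ : ∀ m n s → shift (m ℕ.+ n) s ≗ shift m (shift n s)
shift-+ zero    n s i       = refl
shift-+ (suc m) n s zero    = refl
shift-+ (suc m) n s (suc i) = shift-+ m n s i

shift-+ᵢ : ∀ c s i → shift c s (c ℕ.+ i) ≡ s i
shift-+ᵢ zero    s i = refl
shift-+ᵢ (suc c) s i = shift-+ᵢ c s i

shift-below : ∀ c s i → i < c → shift c s i ≡ + 0
shift-below (suc c) s zero    _         = refl
shift-below (suc c) s (suc i) (s≤s i<c) = shift-below c s i i<c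

shift-local : ∀ k {X Y} n → (∀ m → m ≤ n → X m ≡ Y m) → shift k X n ≡ shift k Y n
shift-local zero    n       h = h n ℕP.≤-refl
shift-local (suc k) zero    h = refl
shift-local (suc k) (suc n) h = shift-local k n (λ m m≤n → h m (ℕP.m≤n⇒m≤1+n m≤n))

⊛-zeroˡ : ∀ {s} t → (∀ i → s i ≡ + 0) → ∀ n → (s ⊛ t) n ≡ + 0
⊛-zeroˡ t z zero    rewrite z 0 = refl
⊛-zeroˡ t z (suc n) rewrite z 0 = trans (ℤP.+-identityˡ _) (⊛-zeroˡ t (λ i → z (suc i)) n)

⊛-identityˡ : ∀ t → δ ⊛ t ≗ t
⊛-identityˡ t zero    = ℤP.*-identityˡ (t 0)
⊛-identityˡ t (suc n) =
  trans (cong₂ ℤ._+_ (ℤP.*-identityˡ (t (suc n))) (⊛-zeroˡ t (λ _ → refl) n)) (ℤP.+-identityʳ _)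

⊛-distribʳ-⊕ : ∀ u w t → (u ⊕ w) ⊛ t ≗ u ⊛ t ⊕ w ⊛ t
⊛-distribʳ-⊕ u w t zero    = ℤP.*-distribʳ-+ (t 0) (u 0) (w 0)
⊛-distribʳ-⊕ u w t (suc n) =
  trans (cong (λ m → (u 0 ℤ.+ w 0) ℤ.* t (suc n) ℤ.+ m) (⊛-distribʳ-⊕ (tail u) (tail w) t n))
        (ring (u 0) (w 0) (t (suc n)) ((tail u ⊛ t) n) ((tail w ⊛ t) n))
  where
  ring : ∀ a b c x y → (a ℤ.+ b) ℤ.* c ℤ.+ (x ℤ.+ y) ≡ (a ℤ.* c ℤ.+ x) ℤ.+ (b ℤ.* c ℤ.+ y)
  ring = solve-∀

⊛-⊙ˡ : ∀ a u t → (a ⊙ u) ⊛ t ≗ a ⊙ (u ⊛ t)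
⊛-⊙ˡ a u t zero    = ℤP.*-assoc a (u 0) (t 0)
⊛-⊙ˡ a u t (suc n) =
  trans (cong (λ m → a ℤ.* u 0 ℤ.* t (suc n) ℤ.+ m) (⊛-⊙ˡ a (tail u) t n))
        (ring a (u 0) (t (suc n)) ((tail u ⊛ t) n))
  where
  ring : ∀ a u t m → a ℤ.* u ℤ.* t ℤ.+ a ℤ.* m ≡ a ℤ.* (u ℤ.* t ℤ.+ m)
  ring = solve-∀

shift-⊛ˡ : ∀ k u t → shift k u ⊛ t ≗ shift k (u ⊛ t)
shift-⊛ˡ zero    u t n       = refl
shift-⊛ˡ (suc k) u t zero    = refl
shift-⊛ˡ (suc k) u t (suc n) = trans (ℤP.+-identityˡ _) (shift-⊛ˡ k u t n)

⊛-unfold : ∀ s t → s ⊛ t ≗ s 0 ⊙ t ⊕ shift 1 (tail s ⊛ t)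
⊛-unfold s t zero    = sym (ℤP.+-identityʳ _)
⊛-unfold s t (suc n) = refl

⊛-assoc : ∀ s t u → (s ⊛ t) ⊛ u ≗ s ⊛ (t ⊛ u)
⊛-assoc s t u zero    = ℤP.*-assoc (s 0) (t 0) (u 0)
⊛-assoc s t u (suc n) =
  trans (cong (λ m → s 0 ℤ.* t 0 ℤ.* u (suc n) ℤ.+ m)
          (trans (⊛-distribʳ-⊕ (s 0 ⊙ tail t) (tail s ⊛ t) u n)
                 (cong₂ ℤ._+_ (⊛-⊙ˡ (s 0) (tail t) u n) (⊛-assoc (tail s) t u n))))
        (ring (s 0) (t 0) (u (suc n)) ((tail t ⊛ u) n) ((tail s ⊛ (t ⊛ u)) n))
  where
  ring : ∀ a b c m x → a ℤ.* b ℤ.* c ℤ.+ (a ℤ.* m ℤ.+ x) ≡ a ℤ.* (b ℤ.* c ℤ.+ m) ℤ.+ x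
  ring = solve-∀

⊛-comm : ∀ s t → s ⊛ t ≗ t ⊛ s
⊛-comm s t zero          = ℤP.*-comm (s 0) (t 0)
⊛-comm s t (suc zero)    = ring (s 0) (t 1) (s 1) (t 0)
  where
  ring : ∀ a b c d → a ℤ.* b ℤ.+ c ℤ.* d ≡ d ℤ.* c ℤ.+ b ℤ.* a
  ring = solve-∀
⊛-comm s t (suc (suc m)) =
  trans (cong (λ x → s 0 ℤ.* t (2 ℕ.+ m) ℤ.+ x)
          (trans (⊛-comm (tail s) t (suc m))
                 (cong (λ x → t 0 ℤ.* s (2 ℕ.+ m) ℤ.+ x) (⊛-comm (tail t) (tail s) m))))
  (trans (ring (s 0 ℤ.* t (2 ℕ.+ m)) (t 0 ℤ.* s (2 ℕ.+ m)) ((tail s ⊛ tail t) m))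
         (cong (λ x → t 0 ℤ.* s (2 ℕ.+ m) ℤ.+ x) (⊛-comm s (tail t) (suc m))))
  where
  ring : ∀ a b x → a ℤ.+ (b ℤ.+ x) ≡ b ℤ.+ (a ℤ.+ x)
  ring = solve-∀

⊛-identityʳ : ∀ t → t ⊛ δ ≗ t
⊛-identityʳ t i = trans (⊛-comm t δ i) (⊛-identityˡ t i)

shift-⊛ʳ : ∀ k s t → s ⊛ shift k t ≗ shift k (s ⊛ t)
shift-⊛ʳ k s t i = trans (⊛-comm s (shift k t) i) (trans (shift-⊛ˡ k t s i) (shift-cong k (⊛-comm t s) i))

⊛-interchange : ∀ a x a' x' → (a ⊛ x) ⊛ (a' ⊛ x') ≗ (a ⊛ a') ⊛ (x ⊛ x')
⊛-interchange a x a' x' i =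
  begin
    ((a ⊛ x) ⊛ (a' ⊛ x')) i      ≡⟨ ⊛-assoc a x (a' ⊛ x') i ⟩
    (a ⊛ (x ⊛ (a' ⊛ x'))) i      ≡⟨ ⊛-cong (λ _ → refl) (λ j → sym (⊛-assoc x a' x' j)) i ⟩
    (a ⊛ ((x ⊛ a') ⊛ x')) i      ≡⟨ ⊛-cong (λ _ → refl) (⊛-cong (⊛-comm x a') (λ _ → refl)) i ⟩
    (a ⊛ ((a' ⊛ x) ⊛ x')) i      ≡⟨ ⊛-cong (λ _ → refl) (⊛-assoc a' x x') i ⟩
    (a ⊛ (a' ⊛ (x ⊛ x'))) i      ≡⟨ sym (⊛-assoc a a' (x ⊛ x') i) ⟩
    ((a ⊛ a') ⊛ (x ⊛ x')) i      ∎
  where open ≡-Reasoning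

inverse-unique : ∀ F I J → F ⊛ I ≗ δ → F ⊛ J ≗ δ → I ≗ J
inverse-unique F I J FI=1 FJ=1 i =
  begin
    I i                 ≡⟨ sym (⊛-identityʳ I i) ⟩
    (I ⊛ δ) i           ≡⟨ ⊛-cong (λ _ → refl) (λ j → sym (FJ=1 j)) i ⟩
    (I ⊛ (F ⊛ J)) i     ≡⟨ sym (⊛-assoc I F J i) ⟩
    ((I ⊛ F) ⊛ J) i     ≡⟨ ⊛-cong (λ j → trans (⊛-comm I F j) (FI=1 j)) (λ _ → refl) i ⟩
    (δ ⊛ J) i           ≡⟨ ⊛-identityˡ J i ⟩
    J i                 ∎
  where open ≡-Reasoning

powS-constant : ∀ s → s 0 ≡ + 1 → ∀ e → powS s e 0 ≡ + 1
powS-constant s h zero    = refl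
powS-constant s h (suc e) rewrite h | powS-constant s h e = refl

-- Finite products Π_{l<L} G_l, multiplied on the right as in prodPoly.
prodS : ℕ → (ℕ → Series) → Series
prodS zero    G = δ
prodS (suc L) G = prodS L G ⊛ G L

prodS-cong : ∀ L {G H} → (∀ l → G l ≗ H l) → prodS L G ≗ prodS L H
prodS-cong zero    h i = refl
prodS-cong (suc L) h   = ⊛-cong (prodS-cong L h) (h L)

prodS-peel : ∀ L G → prodS (suc L) G ≗ G 0 ⊛ prodS L (λ l → G (suc l))
prodS-peel zero    G i = ⊛-comm δ (G 0) i
prodS-peel (suc L) G i = trans (⊛-cong (prodS-peel L G) (λ _ → refl) i) (⊛-assoc (G 0) _ (G (suc L)) i)

prodS-pad : ∀ L M G → L ≤ M → (∀ l → L ≤ l → G l ≗ δ) → prodS M G ≗ prodS L G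
prodS-pad L M G L≤M trivial i = subst (λ K → prodS K G i ≡ prodS L G i) (ℕP.m∸n+n≡m L≤M) (pad (M ∸ L) i)
  where
  pad : ∀ k → prodS (k ℕ.+ L) G ≗ prodS L G
  pad zero    i = refl
  pad (suc k) i = trans (⊛-cong (pad k) (trivial (k ℕ.+ L) (ℕP.m≤n+m L k)) i) (⊛-identityʳ (prodS L G) i)

prodS-constant : ∀ L G → (∀ l → G l 0 ≡ + 1) → prodS L G 0 ≡ + 1
prodS-constant zero    G h = refl
prodS-constant (suc L) G h rewrite prodS-constant L G h | h L = refl

coeff-addP : ∀ p q i → coeff (addP p q) i ≡ coeff p i ℤ.+ coeff q i
coeff-addP []      q       i       = sym (ℤP.+-identityˡ _)
coeff-addP (a ∷ p) []      i       = sym (ℤP.+-identityʳ _)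
coeff-addP (a ∷ p) (c ∷ q) zero    = refl
coeff-addP (a ∷ p) (c ∷ q) (suc i) = coeff-addP p q i

coeff-scaleP : ∀ a q i → coeff (scaleP a q) i ≡ a ℤ.* coeff q i
coeff-scaleP a []      i       = sym (ℤP.*-zeroʳ a)
coeff-scaleP a (c ∷ q) zero    = refl
coeff-scaleP a (c ∷ q) (suc i) = coeff-scaleP a q i

coeff-mulP : ∀ p q → coeff (mulP p q) ≗ coeff p ⊛ coeff q
coeff-mulP []      q i       = sym (⊛-zeroˡ (coeff q) (λ _ → refl) i)
coeff-mulP (a ∷ p) q zero    =
  trans (coeff-addP (scaleP a q) (+ 0 ∷ mulP p q) 0) (trans (ℤP.+-identityʳ _) (coeff-scaleP a q 0))
coeff-mulP (a ∷ p) q (suc i) =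
  trans (coeff-addP (scaleP a q) (+ 0 ∷ mulP p q) (suc i)) (cong₂ ℤ._+_ (coeff-scaleP a q (suc i)) (coeff-mulP p q i))

coeff-one : coeff [ + 1 ] ≗ δ
coeff-one zero    = refl
coeff-one (suc i) = refl

coeff-powP : ∀ p e → coeff (powP p e) ≗ powS (coeff p) e
coeff-powP p zero            = coeff-one
coeff-powP p (suc e) i = trans (coeff-mulP p (powP p e) i) (⊛-cong (λ _ → refl) (coeff-powP p e) i)

coeff-prodPoly : ∀ L g → coeff (prodPoly L g) ≗ prodS L (λ l → coeff (g l))
coeff-prodPoly zero    g = coeff-one
coeff-prodPoly (suc L) g i =
  trans (coeff-mulP (prodPoly L g) (g L) i) (⊛-cong (coeff-prodPoly L g) (λ _ → refl) i)

onePlusX^ : ℕ → Series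
onePlusX^ c = δ ⊕ shift c δ

coeff-onePlusXPow : ∀ c → coeff (onePlusXPow c) ≗ onePlusX^ c
coeff-onePlusXPow c i =
  trans (coeff-addP [ + 1 ] (replicate c (+ 0) ++ [ + 1 ]) i) (cong₂ ℤ._+_ (coeff-one i) (monomial c i))
  where
  monomial : ∀ c → coeff (replicate c (+ 0) ++ [ + 1 ]) ≗ shift c δ
  monomial zero    = coeff-one
  monomial (suc c) zero    = refl
  monomial (suc c) (suc i) = monomial c i

⊛-onePlusX^ : ∀ c u → u ⊛ onePlusX^ c ≗ u ⊕ shift c u
⊛-onePlusX^ c u i =
  trans (⊛-comm u (onePlusX^ c) i)
        (trans (⊛-distribʳ-⊕ δ (shift c δ) u i)
               (cong₂ ℤ._+_ (⊛-identityˡ u i) (trans (shift-⊛ˡ c δ u i) (shift-cong c (⊛-identityˡ u) i))))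

coeff-++ˡ : ∀ (xs ys : List ℤ) i → i < length xs → coeff (xs ++ ys) i ≡ coeff xs i
coeff-++ˡ (x ∷ xs) ys zero    _         = refl
coeff-++ˡ (x ∷ xs) ys (suc i) (s≤s i<n) = coeff-++ˡ xs ys i i<n

coeff-++-last : ∀ (xs : List ℤ) y → coeff (xs ++ [ y ]) (length xs) ≡ y
coeff-++-last []       y = refl
coeff-++-last (x ∷ xs) y = coeff-++-last xs y

coeff-++-beyond : ∀ (xs : List ℤ) y i → length xs < i → coeff (xs ++ [ y ]) i ≡ + 0
coeff-++-beyond []       y (suc i) _         = refl
coeff-++-beyond (x ∷ xs) y (suc i) (s≤s n<i) = coeff-++-beyond xs y i n<i

invList-length : ∀ p k → length (invList p k) ≡ suc k
invList-length p zero    = refl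
invList-length p (suc k) =
  trans (LP.length-++ (invList p k)) (trans (ℕP.+-comm (length (invList p k)) 1) (cong suc (invList-length p k)))

invList-prefix : ∀ p k i → i ≤ k → coeff (invList p k) i ≡ invCoeff p i
invList-prefix p zero    zero le = refl
invList-prefix p (suc k) i    le with i ℕ.≟ suc k
... | yes refl = refl
... | no  i≢k  =
  trans (coeff-++ˡ (invList p k) _ i (subst (i <_) (sym (invList-length p k)) i<k+1))
        (invList-prefix p k i (ℕP.≤-pred i<k+1))
  where
  i<k+1 : i < suc k
  i<k+1 = ℕP.≤∧≢⇒< le i≢k

invCoeff-recurrence : ∀ p k →
  invCoeff p (suc k) ≡ ℤ.- sumZ (map (λ i → coeff p (suc i) ℤ.* invCoeff p (k ∸ i)) (upTo (suc k)))
invCoeff-recurrence p k =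
  trans (subst (λ n → coeff (invList p k ++ [ new ]) n ≡ new) (invList-length p k) (coeff-++-last (invList p k) new))
        (cong (λ z → ℤ.- sumZ z)
              (LP.map-cong (λ i → cong (coeff p (suc i) ℤ.*_) (invList-prefix p k (k ∸ i) (ℕP.m∸n≤m k i)))
                           (upTo (suc k))))
  where
  new : ℤ
  new = ℤ.- sumZ (map (λ i → coeff p (suc i) ℤ.* coeff (invList p k) (k ∸ i)) (upTo (suc k)))

⊛-as-sum : ∀ s t n → (s ⊛ t) n ≡ sumZ (applyUpTo (λ i → s i ℤ.* t (n ∸ i)) (suc n))
⊛-as-sum s t zero    = sym (ℤP.+-identityʳ _)
⊛-as-sum s t (suc n) = cong (λ x → s 0 ℤ.* t (suc n) ℤ.+ x) (⊛-as-sum (tail s) t n)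

-- p · invCoeff p = 1: the recurrence makes every coefficient beyond the first cancel.
invCoeff-inverse : ∀ p → coeff p 0 ≡ + 1 → coeff p ⊛ invCoeff p ≗ δ
invCoeff-inverse p p₀=1 zero    rewrite p₀=1 = refl
invCoeff-inverse p p₀=1 (suc k) rewrite p₀=1 =
  trans (cong₂ ℤ._+_ (trans (ℤP.*-identityˡ _) (invCoeff-recurrence p k))
                     (trans (⊛-as-sum (tail (coeff p)) (invCoeff p) k) (sym (cong sumZ (LP.map-upTo term (suc k))))))
        (ℤP.+-inverseˡ (sumZ (map term (upTo (suc k)))))
  where
  term : ℕ → ℤ
  term i = coeff p (suc i) ℤ.* invCoeff p (k ∸ i)

invCoeff-cong : ∀ p q → coeff p ≗ coeff q → invCoeff p ≗ invCoeff q
invCoeff-cong p q h k = cong (λ z → coeff z k) (lists k)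
  where
  lists : ∀ k → invList p k ≡ invList q k
  lists zero    = refl
  lists (suc k) rewrite lists k =
    cong (λ z → invList q k ++ [ ℤ.- sumZ z ])
         (LP.map-cong (λ i → cong (ℤ._* coeff (invList q k) (k ∸ i)) (h (suc i))) (upTo (suc k)))

binomialSeries : ℕ → Series
binomialSeries a = powS (onePlusX^ 1) a

negBinomialSeries : ℕ → Series
negBinomialSeries a j = binomZ (- (+ a)) (+ j)

coeff-binomialPoly : ∀ a → coeff (powP (+ 1 ∷ + 1 ∷ []) a) ≗ binomialSeries a
coeff-binomialPoly a i = trans (coeff-powP _ a i) (powS-cong onePlusX a i)
  where
  onePlusX : coeff (+ 1 ∷ + 1 ∷ []) ≗ onePlusX^ 1
  onePlusX zero          = refl
  onePlusX (suc zero)    = refl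
  onePlusX (suc (suc i)) = refl

binomial-inverse : ∀ a → binomialSeries a ⊛ negBinomialSeries a ≗ δ
binomial-inverse zero    i = trans (⊛-cong (λ _ → refl) coeff-one i) (⊛-identityˡ δ i)
binomial-inverse (suc a) i =
  trans (⊛-cong (λ j → sym (coeff-binomialPoly (suc a) j)) (λ _ → refl) i)
        (invCoeff-inverse p (trans (coeff-binomialPoly (suc a) 0) (powS-constant (onePlusX^ 1) refl (suc a))) i)
  where
  p : Poly
  p = powP (+ 1 ∷ + 1 ∷ []) (suc a)

horner : ℕ → ℕ → (ℕ → ℕ) → ℕ
horner B zero    a = 0
horner B (suc N) a = a 0 ℕ.+ horner B N (λ l → a (suc l)) ℕ.* B

horner-top : ∀ B L a → horner B (suc L) a ≡ horner B L a ℕ.+ a L ℕ.* B ^ L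
horner-top B zero    a = trans (ℕP.+-identityʳ (a 0)) (sym (ℕP.*-identityʳ (a 0)))
horner-top B (suc L) a =
  trans (cong (λ z → a 0 ℕ.+ z ℕ.* B) (horner-top B L (λ l → a (suc l))))
        (ring (a 0) (horner B L (λ l → a (suc l))) (a (suc L)) B (B ^ L))
  where
  ring : ∀ a₀ h x B p → a₀ ℕ.+ (h ℕ.+ x ℕ.* p) ℕ.* B ≡ a₀ ℕ.+ h ℕ.* B ℕ.+ x ℕ.* (B ℕ.* p)
  ring = ℕSolver.solve-∀

sumOver-cong : ∀ {A : Set} (xs : List A) {f g} → (∀ x → f x ≡ g x) → sumOver xs f ≡ sumOver xs g
sumOver-cong xs h = cong sumZ (LP.map-cong h xs)

sumOver-filter : ∀ {A : Set} (p : A → Bool) xs f →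
                 sumOver (filterᵇ p xs) f ≡ sumOver xs (λ x → if p x then f x else + 0)
sumOver-filter p []       f = refl
sumOver-filter p (x ∷ xs) f with p x
... | true  = cong (λ z → f x ℤ.+ z) (sumOver-filter p xs f)
... | false = trans (sumOver-filter p xs f) (sym (ℤP.+-identityˡ _))

sumOver-++ : ∀ {A : Set} (xs ys : List A) f → sumOver (xs ++ ys) f ≡ sumOver xs f ℤ.+ sumOver ys f
sumOver-++ []       ys f = sym (ℤP.+-identityˡ _)
sumOver-++ (x ∷ xs) ys f = trans (cong (λ z → f x ℤ.+ z) (sumOver-++ xs ys f)) (sym (ℤP.+-assoc (f x) _ _))

sumOver-concatMap : ∀ {A B : Set} (g : A → List B) xs f →
                    sumOver (concatMap g xs) f ≡ sumOver xs (λ x → sumOver (g x) f)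
sumOver-concatMap g []       f = refl
sumOver-concatMap g (x ∷ xs) f =
  trans (sumOver-++ (g x) (concatMap g xs) f) (cong (λ z → sumOver (g x) f ℤ.+ z) (sumOver-concatMap g xs f))

sumOver-map : ∀ {A B : Set} (h : A → B) xs f → sumOver (map h xs) f ≡ sumOver xs (λ x → f (h x))
sumOver-map h xs f = cong sumZ (sym (LP.map-∘ xs))

sumOver-*ˡ : ∀ {A : Set} (xs : List A) a f → sumOver xs (λ x → a ℤ.* f x) ≡ a ℤ.* sumOver xs f
sumOver-*ˡ []       a f = sym (ℤP.*-zeroʳ a)
sumOver-*ˡ (x ∷ xs) a f =
  trans (cong (λ z → a ℤ.* f x ℤ.+ z) (sumOver-*ˡ xs a f)) (sym (ℤP.*-distribˡ-+ a (f x) _))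

⊛-as-shiftSum : ∀ s D n K → n < K → (s ⊛ D) n ≡ sumOver (upTo K) (λ x → s x ℤ.* shift x D n)
⊛-as-shiftSum s D n K n<K = trans (go s n K n<K) (cong sumZ (sym (LP.map-upTo _ K)))
  where
  vanish : ∀ f K → (∀ x → f x ≡ + 0) → sumZ (applyUpTo f K) ≡ + 0
  vanish f zero    h = refl
  vanish f (suc K) h rewrite h 0 = trans (ℤP.+-identityˡ _) (vanish (λ x → f (suc x)) K (λ x → h (suc x)))
  go : ∀ s n K → n < K → (s ⊛ D) n ≡ sumZ (applyUpTo (λ x → s x ℤ.* shift x D n) K)
  go s zero    (suc K) _ =
    sym (trans (cong (λ z → s 0 ℤ.* D 0 ℤ.+ z) (vanish _ K (λ x → ℤP.*-zeroʳ (s (suc x))))) (ℤP.+-identityʳ _))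
  go s (suc n) (suc K) (s≤s n<K) = cong (λ z → s 0 ℤ.* D (suc n) ℤ.+ z) (go (tail s) n K n<K)

indicator-as-shift : ∀ a m X → (if a ≡ᵇ m then X else + 0) ≡ shift a δ m ℤ.* X
indicator-as-shift zero    zero    X = sym (ℤP.*-identityˡ X)
indicator-as-shift zero    (suc m) X = refl
indicator-as-shift (suc a) zero    X = refl
indicator-as-shift (suc a) (suc m) X = indicator-as-shift a m X

weight-cons : ∀ B N x (v : Vec ℕ N) → weight B (suc N) (x Vec.∷ v) ≡ x ℕ.+ weight B N v ℕ.* B
weight-cons B N x v = cong₂ ℕ._+_ (ℕP.*-identityʳ x) (scale N (lookup v) (λ l → B ^ toℕ l))
  where
  scale : ∀ N (f g : Fin N → ℕ) → sumFinℕ N (λ l → f l ℕ.* (B ℕ.* g l)) ≡ sumFinℕ N (λ l → f l ℕ.* g l) ℕ.* B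
  scale zero    f g = refl
  scale (suc N) f g =
    trans (cong₂ ℕ._+_ (ring (f Fin.zero) B (g Fin.zero)) (scale N (λ l → f (Fin.suc l)) (λ l → g (Fin.suc l))))
          (sym (ℕP.*-distribʳ-+ B (f Fin.zero ℕ.* g Fin.zero) _))
    where
    ring : ∀ x B y → x ℕ.* (B ℕ.* y) ≡ x ℕ.* y ℕ.* B
    ring = ℕSolver.solve-∀

tupleProduct : ∀ N → (ℕ → Series) → Vec ℕ N → ℤ
tupleProduct N c v = prodFinℤ N (λ l → c (toℕ l) (lookup v l))

module Radix (b-1 : ℕ) where

  b : ℕ
  b = suc b-1

  -- stretchIndex n = just m if n = m b, nothing if b ∤ n.  afterGap k n
  -- handles n with k more positions to skip before the next multiple of b.
  mutual
    stretchIndex : ℕ → Maybe ℕ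
    stretchIndex zero    = just 0
    stretchIndex (suc n) = afterGap b-1 n

    afterGap : ℕ → ℕ → Maybe ℕ
    afterGap zero    n       = Maybe.map suc (stretchIndex n)
    afterGap (suc k) zero    = nothing
    afterGap (suc k) (suc n) = afterGap k n

  at : Series → Maybe ℕ → ℤ
  at s (just j) = s j
  at s nothing  = + 0

  -- stretch s (x) = s(x^b).
  stretch : Series → Series
  stretch s n = at s (stretchIndex n)

  stretch-cong : ∀ {s t} → s ≗ t → stretch s ≗ stretch t
  stretch-cong h n with stretchIndex n
  ... | just j  = h j
  ... | nothing = refl

  stretch-⊕ : ∀ s t → stretch (s ⊕ t) ≗ stretch s ⊕ stretch t
  stretch-⊕ s t n with stretchIndex n
  ... | just j  = refl
  ... | nothing = refl

  stretch-⊙ : ∀ a s → stretch (a ⊙ s) ≗ a ⊙ stretch s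
  stretch-⊙ a s n with stretchIndex n
  ... | just j  = refl
  ... | nothing = sym (ℤP.*-zeroʳ a)

  private
    afterGap-shift : ∀ k s n → at s (afterGap k n) ≡ shift k (stretch (tail s)) n
    afterGap-shift zero    s n with stretchIndex n
    ... | just j  = refl
    ... | nothing = refl
    afterGap-shift (suc k) s zero    = refl
    afterGap-shift (suc k) s (suc n) = afterGap-shift k s n

  stretch-unfold : ∀ s → stretch s ≗ s 0 ⊙ δ ⊕ shift b (stretch (tail s))
  stretch-unfold s zero    = sym (trans (ℤP.+-identityʳ _) (ℤP.*-identityʳ _))
  stretch-unfold s (suc n) =
    trans (afterGap-shift b-1 s n)
          (sym (trans (cong (ℤ._+ shift b-1 (stretch (tail s)) n) (ℤP.*-zeroʳ (s 0))) (ℤP.+-identityˡ _)))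

  stretch-δ : stretch δ ≗ δ
  stretch-δ n =
    trans (stretch-unfold δ n) (trans (cong₂ ℤ._+_ (ℤP.*-identityˡ (δ n)) (vanish b n)) (ℤP.+-identityʳ (δ n)))
    where
    zero-tail : ∀ n → stretch (tail δ) n ≡ + 0
    zero-tail n with stretchIndex n
    ... | just j  = refl
    ... | nothing = refl
    vanish : ∀ k n → shift k (stretch (tail δ)) n ≡ + 0
    vanish zero    n       = zero-tail n
    vanish (suc k) zero    = refl
    vanish (suc k) (suc n) = vanish k n

  stretch-shift₁ : ∀ u → stretch (shift 1 u) ≗ shift b (stretch u)
  stretch-shift₁ u n = trans (stretch-unfold (shift 1 u) n) (ℤP.+-identityˡ _)

  stretch-shift : ∀ k u → stretch (shift k u) ≗ shift (k ℕ.* b) (stretch u)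
  stretch-shift zero    u n = refl
  stretch-shift (suc k) u n =
    trans (stretch-cong (shift-+ 1 k u) n)
          (trans (stretch-shift₁ (shift k u) n)
                 (trans (shift-cong b (stretch-shift k u) n) (sym (shift-+ b (k ℕ.* b) (stretch u) n))))

  -- Stretching is multiplicative; by strong induction on the index, since
  -- the recursive product only enters through a shift by b ≥ 1.
  stretch-⊛ : ∀ s t → stretch s ⊛ stretch t ≗ stretch (s ⊛ t)
  stretch-⊛ s t m = <-rec Multiplicative step m s t
    where
    Multiplicative : ℕ → Set
    Multiplicative m = ∀ s t → (stretch s ⊛ stretch t) m ≡ stretch (s ⊛ t) m

    shift-local-< : ∀ {X Y} n → (∀ {m} → m < n → X m ≡ Y m) → shift b X n ≡ shift b Y n
    shift-local-< zero    h = refl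
    shift-local-< (suc n) h = shift-local b-1 n (λ m m≤n → h (s≤s m≤n))

    step : ∀ m → (∀ {m'} → m' < m → Multiplicative m') → Multiplicative m
    step m ih s t =
      begin
        (stretch s ⊛ stretch t) m
      ≡⟨ ⊛-cong (stretch-unfold s) (λ _ → refl) m ⟩
        ((s 0 ⊙ δ ⊕ shift b (stretch (tail s))) ⊛ stretch t) m
      ≡⟨ ⊛-distribʳ-⊕ (s 0 ⊙ δ) _ (stretch t) m ⟩
        ((s 0 ⊙ δ) ⊛ stretch t) m ℤ.+ (shift b (stretch (tail s)) ⊛ stretch t) m
      ≡⟨ cong₂ ℤ._+_ (trans (⊛-⊙ˡ (s 0) δ (stretch t) m) (cong (s 0 ℤ.*_) (⊛-identityˡ (stretch t) m)))
                     (shift-⊛ˡ b (stretch (tail s)) (stretch t) m) ⟩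
        s 0 ℤ.* stretch t m ℤ.+ shift b (stretch (tail s) ⊛ stretch t) m
      ≡⟨ cong₂ ℤ._+_ (sym (stretch-⊙ (s 0) t m))
                     (trans (shift-local-< m (λ m'<m → ih m'<m (tail s) t)) (sym (stretch-shift₁ (tail s ⊛ t) m))) ⟩
        stretch (s 0 ⊙ t) m ℤ.+ stretch (shift 1 (tail s ⊛ t)) m
      ≡⟨ sym (stretch-⊕ (s 0 ⊙ t) _ m) ⟩
        stretch (s 0 ⊙ t ⊕ shift 1 (tail s ⊛ t)) m
      ≡⟨ sym (stretch-cong (⊛-unfold s t) m) ⟩
        stretch (s ⊛ t) m
      ∎
      where open ≡-Reasoning

  stretch-powS : ∀ s e → stretch (powS s e) ≗ powS (stretch s) e
  stretch-powS s zero    = stretch-δ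
  stretch-powS s (suc e) n = trans (sym (stretch-⊛ s (powS s e) n)) (⊛-cong (λ _ → refl) (stretch-powS s e) n)

  stretch-prodS : ∀ L G → prodS L (λ l → stretch (G l)) ≗ stretch (prodS L G)
  stretch-prodS zero    G i = sym (stretch-δ i)
  stretch-prodS (suc L) G i = trans (⊛-cong (stretch-prodS L G) (λ _ → refl) i) (stretch-⊛ (prodS L G) (G L) i)

  stretch-onePlusX^ : ∀ k → stretch (onePlusX^ k) ≗ onePlusX^ (k ℕ.* b)
  stretch-onePlusX^ k i =
    trans (stretch-⊕ δ (shift k δ) i)
          (cong₂ ℤ._+_ (stretch-δ i) (trans (stretch-shift k δ i) (shift-cong (k ℕ.* b) stretch-δ i)))

  shift-stretch-at : ∀ k n → Σ (Maybe ℕ) λ p → ∀ s → shift k (stretch s) n ≡ at s p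
  shift-stretch-at zero    n       = stretchIndex n , λ s → refl
  shift-stretch-at (suc k) zero    = nothing , λ s → refl
  shift-stretch-at (suc k) (suc n) = shift-stretch-at k n

  mutual
    stretchIndex-≤ : ∀ n j → stretchIndex n ≡ just j → j ≤ n
    stretchIndex-≤ zero    j refl = z≤n
    stretchIndex-≤ (suc n) j eq   = afterGap-≤ b-1 n j eq

    afterGap-≤ : ∀ k n j → afterGap k n ≡ just j → j ≤ suc n
    afterGap-≤ zero    n j eq with stretchIndex n in e
    afterGap-≤ zero    n .(suc j) refl | just j = s≤s (stretchIndex-≤ n j e)
    afterGap-≤ (suc k) (suc n) j eq = ℕP.m≤n⇒m≤1+n (afterGap-≤ k n j eq)

  stretch-local : ∀ {s t} n → (∀ j → j ≤ n → s j ≡ t j) → stretch s n ≡ stretch t n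
  stretch-local n h with stretchIndex n in eq
  ... | just j  = h j (stretchIndex-≤ n j eq)
  ... | nothing = refl

  -- Π_{l<N} c_l(x^{b^l}), in Horner form c₀(x) · (Π_{l<N-1} c_{l+1}(x^{b^l}))(x^b).
  stretchedProduct : ℕ → (ℕ → Series) → Series
  stretchedProduct zero    c = δ
  stretchedProduct (suc N) c = c 0 ⊛ stretch (stretchedProduct N (λ l → c (suc l)))

  stretchedProduct-inverse : ∀ N A C → (∀ l → A l ⊛ C l ≗ δ) →
                             stretchedProduct N A ⊛ stretchedProduct N C ≗ δ
  stretchedProduct-inverse zero    A C h = ⊛-identityˡ δ
  stretchedProduct-inverse (suc N) A C h i =
    begin
      (stretchedProduct (suc N) A ⊛ stretchedProduct (suc N) C) i
    ≡⟨ ⊛-interchange (A 0) (stretch A′) (C 0) (stretch C′) i ⟩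
      ((A 0 ⊛ C 0) ⊛ (stretch A′ ⊛ stretch C′)) i
    ≡⟨ ⊛-cong (h 0) (λ j → trans (stretch-⊛ A′ C′ j) (stretch-cong ih j)) i ⟩
      (δ ⊛ stretch δ) i
    ≡⟨ trans (⊛-identityˡ (stretch δ) i) (stretch-δ i) ⟩
      δ i
    ∎
    where
    open ≡-Reasoning
    A′ C′ : Series
    A′ = stretchedProduct N (λ l → A (suc l))
    C′ = stretchedProduct N (λ l → C (suc l))
    ih : A′ ⊛ C′ ≗ δ
    ih = stretchedProduct-inverse N (λ l → A (suc l)) (λ l → C (suc l)) (λ l → h (suc l))

  prodS-as-stretchedProduct : ∀ N a →
    prodS N (λ l → powS (onePlusX^ (b ^ l)) (a l)) ≗ stretchedProduct N (λ l → binomialSeries (a l))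
  prodS-as-stretchedProduct zero    a i = refl
  prodS-as-stretchedProduct (suc N) a i =
    begin
      prodS (suc N) (factor a) i
    ≡⟨ prodS-peel N (factor a) i ⟩
      (binomialSeries (a 0) ⊛ prodS N (λ l → factor a (suc l))) i
    ≡⟨ ⊛-cong (λ _ → refl) (prodS-cong N (factor-stretch a)) i ⟩
      (binomialSeries (a 0) ⊛ prodS N (λ l → stretch (factor (λ l → a (suc l)) l))) i
    ≡⟨ ⊛-cong (λ _ → refl) (λ j → trans (stretch-prodS N _ j)
                                          (stretch-cong (prodS-as-stretchedProduct N (λ l → a (suc l))) j)) i ⟩
      stretchedProduct (suc N) (λ l → binomialSeries (a l)) i
    ∎
    where
    open ≡-Reasoning
    factor : (ℕ → ℕ) → ℕ → Series
    factor a l = powS (onePlusX^ (b ^ l)) (a l)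
    factor-stretch : ∀ a l → factor a (suc l) ≗ stretch (factor (λ k → a (suc k)) l)
    factor-stretch a l j =
      sym (trans (stretch-powS (onePlusX^ (b ^ l)) (a (suc l)) j)
                 (powS-cong (λ k → trans (stretch-onePlusX^ (b ^ l) k)
                                         (cong (λ e → onePlusX^ e k) (ℕP.*-comm (b ^ l) b))) (a (suc l)) j))

  stretchedProduct-shift : ∀ N a c →
    stretchedProduct N (λ l → shift (a l) (c l)) ≗ shift (horner b N a) (stretchedProduct N c)
  stretchedProduct-shift zero    a c i = refl
  stretchedProduct-shift (suc N) a c i =
    begin
      (shift (a 0) (c 0) ⊛ stretch (stretchedProduct N (λ l → shift (a (suc l)) (c (suc l))))) i
    ≡⟨ ⊛-cong (λ _ → refl) (λ j → trans (stretch-cong ih j) (stretch-shift h′ Q′ j)) i ⟩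
      (shift (a 0) (c 0) ⊛ shift (h′ ℕ.* b) (stretch Q′)) i
    ≡⟨ shift-⊛ˡ (a 0) (c 0) _ i ⟩
      shift (a 0) (c 0 ⊛ shift (h′ ℕ.* b) (stretch Q′)) i
    ≡⟨ shift-cong (a 0) (shift-⊛ʳ (h′ ℕ.* b) (c 0) (stretch Q′)) i ⟩
      shift (a 0) (shift (h′ ℕ.* b) (c 0 ⊛ stretch Q′)) i
    ≡⟨ sym (shift-+ (a 0) (h′ ℕ.* b) _ i) ⟩
      shift (horner b (suc N) a) (stretchedProduct (suc N) c) i
    ∎
    where
    open ≡-Reasoning
    h′ : ℕ
    h′ = horner b N (λ l → a (suc l))
    Q′ : Series
    Q′ = stretchedProduct N (λ l → c (suc l))
    ih : stretchedProduct N (λ l → shift (a (suc l)) (c (suc l))) ≗ shift h′ Q′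
    ih = stretchedProduct-shift N (λ l → a (suc l)) (λ l → c (suc l))

  at-sumOver : ∀ {A : Set} (vs : List A) (S : A → Series) (r : A → ℤ) p →
               sumOver vs (λ v → at (S v) p ℤ.* r v) ≡ at (λ j → sumOver vs (λ v → S v j ℤ.* r v)) p
  at-sumOver vs       S r (just j) = refl
  at-sumOver []       S r nothing  = refl
  at-sumOver (v ∷ vs) S r nothing  = trans (ℤP.+-identityˡ _) (at-sumOver vs S r nothing)

  tupleSum : ℕ → ℕ → (ℕ → Series) → Series
  tupleSum N B c m = sumOver (allVecs N B) (λ v → shift (weight b N v) δ m ℤ.* tupleProduct N c v)

  tupleSum-step : ∀ N B c m →
    tupleSum (suc N) B c m
      ≡ sumOver (upTo (suc B)) (λ j → c 0 j ℤ.* shift j (stretch (tupleSum N B (λ l → c (suc l)))) m)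
  tupleSum-step N B c m =
    trans (sumOver-concatMap (λ j → map (j Vec.∷_) (allVecs N B)) (upTo (suc B)) _)
          (sumOver-cong (upTo (suc B)) first-entry)
    where
    R : Vec ℕ N → ℤ
    R = tupleProduct N (λ l → c (suc l))

    first-entry : ∀ j →
      sumOver (map (j Vec.∷_) (allVecs N B)) (λ v → shift (weight b (suc N) v) δ m ℤ.* tupleProduct (suc N) c v)
        ≡ c 0 j ℤ.* shift j (stretch (tupleSum N B (λ l → c (suc l)))) m
    first-entry j =
      begin
        sumOver (map (j Vec.∷_) vs) (λ v → shift (weight b (suc N) v) δ m ℤ.* tupleProduct (suc N) c v)
      ≡⟨ sumOver-map (j Vec.∷_) vs _ ⟩
        sumOver vs (λ v → shift (weight b (suc N) (j Vec.∷ v)) δ m ℤ.* (c 0 j ℤ.* R v))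
      ≡⟨ sumOver-cong vs (λ v → trans (cong (ℤ._* (c 0 j ℤ.* R v)) (monomial v)) (ring (x^w v) (c 0 j) (R v))) ⟩
        sumOver vs (λ v → c 0 j ℤ.* (x^w v ℤ.* R v))
      ≡⟨ sumOver-*ˡ vs (c 0 j) _ ⟩
        c 0 j ℤ.* sumOver vs (λ v → x^w v ℤ.* R v)
      ≡⟨ cong (c 0 j ℤ.*_) (trans (at-sumOver vs (λ v → shift (weight b N v) δ) R p)
                                   (sym (locate (tupleSum N B (λ l → c (suc l)))))) ⟩
        c 0 j ℤ.* shift j (stretch (tupleSum N B (λ l → c (suc l)))) m
      ∎
      where
      open ≡-Reasoning
      vs : List (Vec ℕ N)
      vs = allVecs N B
      p : Maybe ℕ
      p = proj₁ (shift-stretch-at j m)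
      locate : ∀ s → shift j (stretch s) m ≡ at s p
      locate = proj₂ (shift-stretch-at j m)
      x^w : Vec ℕ N → ℤ
      x^w v = at (shift (weight b N v) δ) p
      ring : ∀ a c r → a ℤ.* (c ℤ.* r) ≡ c ℤ.* (a ℤ.* r)
      ring = solve-∀
      monomial : ∀ v → shift (weight b (suc N) (j Vec.∷ v)) δ m ≡ x^w v
      monomial v =
        begin
          shift (weight b (suc N) (j Vec.∷ v)) δ m
        ≡⟨ cong (λ e → shift e δ m) (weight-cons b N j v) ⟩
          shift (j ℕ.+ w ℕ.* b) δ m
        ≡⟨ shift-+ j (w ℕ.* b) δ m ⟩
          shift j (shift (w ℕ.* b) δ) m
        ≡⟨ shift-cong j (λ i → trans (shift-cong (w ℕ.* b) (λ i′ → sym (stretch-δ i′)) i)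
                                     (sym (stretch-shift w δ i))) m ⟩
          shift j (stretch (shift w δ)) m
        ≡⟨ locate (shift w δ) ⟩
          x^w v
        ∎
        where
        w : ℕ
        w = weight b N v

  -- For m ≤ B the bound B on the entries is irrelevant, and tupleSum is the stretched product.
  tupleSum-stretchedProduct : ∀ B N c m → m ≤ B → tupleSum N B c m ≡ stretchedProduct N c m
  tupleSum-stretchedProduct B zero    c m m≤B = trans (ℤP.+-identityʳ _) (ℤP.*-identityʳ _)
  tupleSum-stretchedProduct B (suc N) c m m≤B =
    trans (tupleSum-step N B c m)
          (trans (sumOver-cong (upTo (suc B)) (λ x → cong (c 0 x ℤ.*_) (shift-local x m (λ m′ m′≤m →
                    stretch-local m′ (λ j j≤m′ → tupleSum-stretchedProduct B N (λ l → c (suc l)) j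
                                                    (ℕP.≤-trans j≤m′ (ℕP.≤-trans m′≤m m≤B)))))))
                 (sym (⊛-as-shiftSum (c 0) (stretch (stretchedProduct N (λ l → c (suc l)))) m (suc B) (s≤s m≤B))))

  Ptuples-stretchedProduct : ∀ N m c → sumOver (Ptuples b N m) (tupleProduct N c) ≡ stretchedProduct N c m
  Ptuples-stretchedProduct N m c =
    trans (sumOver-filter (λ v → weight b N v ≡ᵇ m) (allVecs N m) (tupleProduct N c))
          (trans (sumOver-cong (allVecs N m) (λ v → indicator-as-shift (weight b N v) m (tupleProduct N c v)))
                 (tupleSum-stretchedProduct m N c m ℕP.≤-refl))

-- Palindromic L s: s is a polynomial of degree L, monic, whose coefficient
-- list reads the same backwards.  f_{n,b} is palindromic of degree n, which
-- turns its expansion in 1/x into a shift of its expansion about 0.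
Palindromic : ℕ → Series → Set
Palindromic L s = (∀ i → L < i → s i ≡ + 0) × (s L ≡ + 1) × (∀ i → i ≤ L → s (L ∸ i) ≡ s i)

palindromic-cong : ∀ {L s t} → s ≗ t → Palindromic L s → Palindromic L t
palindromic-cong {L} e (above , top , mirror) =
  (λ i L<i → trans (sym (e i)) (above i L<i)) ,
  trans (sym (e L)) top ,
  (λ i i≤L → trans (sym (e (L ∸ i))) (trans (mirror i i≤L) (e i)))

palindromic-δ : Palindromic 0 δ
palindromic-δ = (λ { (suc i) _ → refl }) , refl , λ { zero _ → refl }

palindromic-⊛-onePlusX^ : ∀ L c u → 1 ≤ c → Palindromic L u → Palindromic (L ℕ.+ c) (u ⊛ onePlusX^ c)
palindromic-⊛-onePlusX^ L c u 1≤c (above , top , mirror) =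
  palindromic-cong (λ i → sym (⊛-onePlusX^ c u i)) (above′ , top′ , mirror′)
  where
  reflect : ∀ i → i ≤ L ℕ.+ c → u (L ℕ.+ c ∸ i) ≡ shift c u i
  reflect i i≤L+c with c ℕ.≤? i
  ... | no c≰i = trans (above (L ℕ.+ c ∸ i) L<L+c∸i) (sym (shift-below c u i i<c))
    where
    i<c : i < c
    i<c = ℕP.≰⇒> c≰i
    L<L+c∸i : L < L ℕ.+ c ∸ i
    L<L+c∸i = subst (L <_) (sym (ℕP.+-∸-assoc L (ℕP.<⇒≤ i<c))) (ℕP.m<m+n L (ℕP.m<n⇒0<n∸m i<c))
  ... | yes c≤i with i ∸ c | ℕP.m+[n∸m]≡n c≤i
  ...   | j | refl = trans (cong u L+c∸[c+j]≡L∸j) (trans (mirror j j≤L) (sym (shift-+ᵢ c u j)))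
    where
    L+c∸[c+j]≡L∸j : L ℕ.+ c ∸ (c ℕ.+ j) ≡ L ∸ j
    L+c∸[c+j]≡L∸j = trans (cong (_∸ (c ℕ.+ j)) (ℕP.+-comm L c)) (ℕP.[m+n]∸[m+o]≡n∸o c L j)
    j≤L : j ≤ L
    j≤L = ℕP.+-cancelˡ-≤ c j L (subst (c ℕ.+ j ≤_) (ℕP.+-comm L c) i≤L+c)

  above′ : ∀ i → L ℕ.+ c < i → (u ⊕ shift c u) i ≡ + 0
  above′ i L+c<i with i ∸ c | ℕP.m+[n∸m]≡n (ℕP.≤-trans (ℕP.m≤n+m c L) (ℕP.<⇒≤ L+c<i))
  ... | j | refl =
    cong₂ ℤ._+_ (above (c ℕ.+ j) (ℕP.≤-trans (s≤s (ℕP.m≤m+n L c)) L+c<i)) (trans (shift-+ᵢ c u j) (above j L<j))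
    where
    L<j : L < j
    L<j = ℕP.+-cancelˡ-< c L j (subst (_< c ℕ.+ j) (ℕP.+-comm L c) L+c<i)

  top′ : (u ⊕ shift c u) (L ℕ.+ c) ≡ + 1
  top′ = cong₂ ℤ._+_ (above (L ℕ.+ c) (ℕP.m<m+n L 1≤c))
                     (trans (cong (shift c u) (ℕP.+-comm L c)) (trans (shift-+ᵢ c u L) top))

  mirror′ : ∀ i → i ≤ L ℕ.+ c → (u ⊕ shift c u) (L ℕ.+ c ∸ i) ≡ (u ⊕ shift c u) i
  mirror′ i i≤L+c =
    trans (cong₂ ℤ._+_ (reflect i i≤L+c)
                       (trans (sym (reflect (L ℕ.+ c ∸ i) (ℕP.m∸n≤m (L ℕ.+ c) i)))
                              (cong u (ℕP.m∸[m∸n]≡n i≤L+c))))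
          (ℤP.+-comm (shift c u i) (u i))

palindromic-⊛-pow : ∀ L c u → 1 ≤ c → Palindromic L u →
                    ∀ a → Palindromic (L ℕ.+ a ℕ.* c) (u ⊛ powS (onePlusX^ c) a)
palindromic-⊛-pow L c u 1≤c P zero    =
  subst (λ k → Palindromic k (u ⊛ δ)) (sym (ℕP.+-identityʳ L)) (palindromic-cong (λ i → sym (⊛-identityʳ u i)) P)
palindromic-⊛-pow L c u 1≤c P (suc a) =
  subst (λ k → Palindromic k (u ⊛ powS (onePlusX^ c) (suc a))) (ℕP.+-assoc L c (a ℕ.* c))
        (palindromic-cong (⊛-assoc u (onePlusX^ c) (powS (onePlusX^ c) a))
                          (palindromic-⊛-pow (L ℕ.+ c) c (u ⊛ onePlusX^ c) 1≤c
                                             (palindromic-⊛-onePlusX^ L c u 1≤c P) a))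

palindromic-prodS : ∀ B → 1 ≤ B → ∀ L a →
                    Palindromic (horner B L a) (prodS L (λ l → powS (onePlusX^ (B ^ l)) (a l)))
palindromic-prodS B 1≤B zero    a = palindromic-δ
palindromic-prodS B 1≤B (suc L) a =
  subst (λ k → Palindromic k (prodS (suc L) (λ l → powS (onePlusX^ (B ^ l)) (a l)))) (sym (horner-top B L a))
        (palindromic-⊛-pow _ (B ^ L) _ (ℕP.m^n>0 B L) (palindromic-prodS B 1≤B L a) (a L))
  where instance _ = ℕ.>-nonZero 1≤B

palindromic-binomial : ∀ a → Palindromic a (binomialSeries a)
palindromic-binomial a =
  subst (λ k → Palindromic k (binomialSeries a)) (ℕP.*-identityʳ a)
        (palindromic-cong (⊛-identityˡ (binomialSeries a)) (palindromic-⊛-pow 0 1 δ ℕP.≤-refl palindromic-δ a))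

-- Trimming as a right fold: consTrim a t prepends a, dropping it when a = 0 and t = [].
consTrim : ℤ → Poly → Poly
consTrim a         (y ∷ ys) = a ∷ y ∷ ys
consTrim (+ zero)  []       = []
consTrim a         []       = [ a ]

trimʳ : Poly → Poly
trimʳ = List.foldr consTrim []

private
  consTrim-snoc : ∀ a ys x → consTrim a (ys ++ [ x ]) ≡ a ∷ (ys ++ [ x ])
  consTrim-snoc a []       x = refl
  consTrim-snoc a (y ∷ ys) x = refl

  reverse-snoc : ∀ x xs a → reverse ((x ∷ xs) ++ [ a ]) ≡ consTrim a (reverse (x ∷ xs))
  reverse-snoc x xs a =
    trans (LP.reverse-++ (x ∷ xs) [ a ])
          (sym (trans (cong (consTrim a) (LP.unfold-reverse x xs))
                      (trans (consTrim-snoc a (reverse xs) x) (cong (a ∷_) (sym (LP.unfold-reverse x xs))))))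

  reverse-dropZeros-snoc : ∀ xs a → reverse (dropZeros (xs ++ [ a ])) ≡ consTrim a (reverse (dropZeros xs))
  reverse-dropZeros-snoc []               (+ zero)  = refl
  reverse-dropZeros-snoc []               (+ suc k) = refl
  reverse-dropZeros-snoc []               -[1+ k ]  = refl
  reverse-dropZeros-snoc (+ zero ∷ xs)    a         = reverse-dropZeros-snoc xs a
  reverse-dropZeros-snoc (+ suc k ∷ xs)   a         = reverse-snoc (+ suc k) xs a
  reverse-dropZeros-snoc (-[1+ k ] ∷ xs)  a         = reverse-snoc -[1+ k ] xs a

trim≡trimʳ : ∀ p → trim p ≡ trimʳ p
trim≡trimʳ []      = refl
trim≡trimʳ (a ∷ p) =
  trans (cong (λ z → reverse (dropZeros z)) (LP.unfold-reverse a p))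
        (trans (reverse-dropZeros-snoc (reverse p) a) (cong (consTrim a) (trim≡trimʳ p)))

coeff-trimʳ : ∀ p → coeff (trimʳ p) ≗ coeff p
coeff-trimʳ []      i       = refl
coeff-trimʳ (a ∷ p) i       = trans (head a (trimʳ p) i) (tail-coeff i)
  where
  head : ∀ a t → coeff (consTrim a t) ≗ coeff (a ∷ t)
  head (+ zero)  []       zero    = refl
  head (+ zero)  []       (suc i) = refl
  head (+ suc k) []       i       = refl
  head -[1+ k ]  []       i       = refl
  head a         (y ∷ ys) i       = refl
  tail-coeff : ∀ i → coeff (a ∷ trimʳ p) i ≡ coeff (a ∷ p) i
  tail-coeff zero    = refl
  tail-coeff (suc i) = coeff-trimʳ p i

trimʳ-zero : ∀ p → (∀ i → coeff p i ≡ + 0) → trimʳ p ≡ []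
trimʳ-zero []      h = refl
trimʳ-zero (a ∷ p) h rewrite trimʳ-zero p (λ i → h (suc i)) | h 0 = refl

length-trimʳ : ∀ p L → coeff p L ≡ + 1 → (∀ i → L < i → coeff p i ≡ + 0) → length (trimʳ p) ≡ suc L
length-trimʳ []      L       () _
length-trimʳ (a ∷ p) zero    a=1 above rewrite a=1 | trimʳ-zero p (λ i → above (suc i) (s≤s z≤n)) = refl
length-trimʳ (a ∷ p) (suc L) top above with trimʳ p | length-trimʳ p L top (λ i L<i → above (suc i) (s≤s L<i))
... | y ∷ ys | len = cong suc len

coeff-reverse : ∀ xs L → length xs ≡ suc L → ∀ i → i ≤ L → coeff (reverse xs) i ≡ coeff xs (L ∸ i)
coeff-reverse (x ∷ xs) L len i i≤L rewrite LP.unfold-reverse x xs with i ℕ.≟ L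
... | yes refl =
  trans (subst (λ k → coeff (reverse xs ++ [ x ]) k ≡ x) length-init (coeff-++-last (reverse xs) x))
        (cong (coeff (x ∷ xs)) (sym (ℕP.n∸n≡0 i)))
  where
  length-init : length (reverse xs) ≡ L
  length-init = trans (LP.length-reverse xs) (ℕP.suc-injective len)
... | no i≢L = inner L (ℕP.suc-injective len) (ℕP.≤∧≢⇒< i≤L i≢L)
  where
  inner : ∀ L → length xs ≡ L → i < L → coeff (reverse xs ++ [ x ]) i ≡ coeff (x ∷ xs) (L ∸ i)
  inner (suc L′) len′ i<L =
    trans (coeff-++ˡ (reverse xs) [ x ] i (subst (i <_) (sym (trans (LP.length-reverse xs) len′)) i<L))
          (trans (coeff-reverse xs L′ len′ i (ℕP.≤-pred i<L))
                 (cong (coeff (x ∷ xs)) (sym (ℕP.+-∸-assoc 1 (ℕP.≤-pred i<L)))))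

coeff-reverse-beyond : ∀ xs L → length xs ≡ suc L → ∀ i → L < i → coeff (reverse xs) i ≡ + 0
coeff-reverse-beyond (x ∷ xs) L len i L<i rewrite LP.unfold-reverse x xs =
  coeff-++-beyond (reverse xs) x i (subst (_< i) (sym (trans (LP.length-reverse xs) (ℕP.suc-injective len))) L<i)

<ᵇ-suc : ∀ L K → (L <ᵇ suc K) ≡ (L ≤ᵇ K)
<ᵇ-suc zero    K = refl
<ᵇ-suc (suc L) K = refl

-- The branch in expandNeg is the coefficient of a shifted series.
if-≤ᵇ-shift : ∀ L K X → (if L ≤ᵇ K then X (K ∸ L) else + 0) ≡ shift L X K
if-≤ᵇ-shift zero    K       X = refl
if-≤ᵇ-shift (suc L) zero    X = refl
if-≤ᵇ-shift (suc L) (suc K) X rewrite <ᵇ-suc L K = if-≤ᵇ-shift L K X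

expandNeg-palindromic : ∀ p L → Palindromic L (coeff p) → ∀ t → expandNeg p -[1+ t ] ≡ shift L (invCoeff p) (suc t)
expandNeg-palindromic p L (above , top , mirror) t
  rewrite trim≡trimʳ p | length-trimʳ p L top above =
  trans (if-≤ᵇ-shift L (suc t) (invCoeff (reverse (trimʳ p))))
        (shift-cong L (invCoeff-cong _ p reversed) (suc t))
  where
  len : length (trimʳ p) ≡ suc L
  len = length-trimʳ p L top above
  reversed : coeff (reverse (trimʳ p)) ≗ coeff p
  reversed i with i ℕ.≤? L
  ... | yes i≤L = trans (coeff-reverse (trimʳ p) L len i i≤L) (trans (coeff-trimʳ p (L ∸ i)) (mirror i i≤L))
  ... | no  i≰L = trans (coeff-reverse-beyond (trimʳ p) L len i (ℕP.≰⇒> i≰L)) (sym (above i (ℕP.≰⇒> i≰L)))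

binomZ-negative : ∀ a j → a ≤ j → binomZ (- (+ a)) (- (+ j)) ≡ shift a (negBinomialSeries a) j
binomZ-negative zero    zero    _ = refl
binomZ-negative zero    (suc j) _ = refl
binomZ-negative (suc a) (suc j) _ =
  expandNeg-palindromic (powP (+ 1 ∷ + 1 ∷ []) (suc a)) (suc a)
    (palindromic-cong (λ i → sym (coeff-binomialPoly (suc a) i)) (palindromic-binomial (suc a))) j

allFinᵇ-true : ∀ N f → allFinᵇ N f ≡ true → ∀ l → f l ≡ true
allFinᵇ-true (suc N) f h l with f Fin.zero in e
allFinᵇ-true (suc N) f h Fin.zero    | true = e
allFinᵇ-true (suc N) f h (Fin.suc l) | true = allFinᵇ-true N (λ i → f (Fin.suc i)) h l

allFinᵇ-false : ∀ N f → allFinᵇ N f ≡ false → Σ (Fin N) λ l → f l ≡ false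
allFinᵇ-false (suc N) f h with f Fin.zero in e
... | false = Fin.zero , e
... | true  = let (l , fl) = allFinᵇ-false N (λ i → f (Fin.suc i)) h in Fin.suc l , fl

prodFinℤ-cong : ∀ N {f g} → (∀ l → f l ≡ g l) → prodFinℤ N f ≡ prodFinℤ N g
prodFinℤ-cong zero    h = refl
prodFinℤ-cong (suc N) h = cong₂ ℤ._*_ (h Fin.zero) (prodFinℤ-cong N (λ l → h (Fin.suc l)))

prodFinℤ-zero : ∀ N g l → g l ≡ + 0 → prodFinℤ N g ≡ + 0
prodFinℤ-zero (suc N) g Fin.zero    h rewrite h = refl
prodFinℤ-zero (suc N) g (Fin.suc l) h rewrite prodFinℤ-zero N (λ i → g (Fin.suc i)) l h = ℤP.*-zeroʳ (g Fin.zero)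

-- Restricting to P*_n amounts to replacing each factor binomZ(-n_l, -j_l) by
-- the coefficient of x^{j_l} in x^{n_l} Σ_i binomZ(-n_l, i) x^i, which vanishes for j_l < n_l.
Pstar-as-Ptuples : ∀ B n N m →
  sumOver (Pstar B n N m) (λ v → prodFinℤ N (λ l → binomZ (- (+ digit B n (toℕ l))) (- (+ lookup v l))))
    ≡ sumOver (Ptuples B N m) (tupleProduct N (λ l → shift (digit B n l) (negBinomialSeries (digit B n l))))
Pstar-as-Ptuples B n N m = trans (sumOver-filter _ (Ptuples B N m) _) (sumOver-cong (Ptuples B N m) restrict)
  where
  a : Fin N → ℕ
  a l = digit B n (toℕ l)

  restrict : ∀ v →
    (if allFinᵇ N (λ l → a l ≤ᵇ lookup v l) then prodFinℤ N (λ l → binomZ (- (+ a l)) (- (+ lookup v l))) else + 0)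
      ≡ tupleProduct N (λ l → shift (digit B n l) (negBinomialSeries (digit B n l))) v
  restrict v with allFinᵇ N (λ l → a l ≤ᵇ lookup v l) in e
  ... | true  = prodFinℤ-cong N (λ l → binomZ-negative (a l) (lookup v l)
                                         (ℕP.≤ᵇ⇒≤ _ _ (subst T (sym (allFinᵇ-true N _ e l)) tt)))
  ... | false =
    let (l , al≰vl) = allFinᵇ-false N _ e
        vl<al       = ℕP.≰⇒> (λ al≤vl → subst T al≰vl (ℕP.≤⇒≤ᵇ al≤vl))
    in sym (prodFinℤ-zero N _ l (shift-below (a l) _ (lookup v l) vl<al))

module Digits (d : ℕ) where

  b : ℕ
  b = suc (suc d)

  open Radix (suc d)
    using (stretchedProduct; stretchedProduct-inverse; prodS-as-stretchedProduct; stretchedProduct-shift;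
           Ptuples-stretchedProduct)

  private
    quotient-bound : ∀ m X → m / b < X → m < b ℕ.* X
    quotient-bound m X m/b<X = begin-strict
      m                     ≡⟨ m≡m%n+[m/n]*n m b ⟩
      m % b ℕ.+ m / b ℕ.* b <⟨ ℕP.+-monoˡ-< (m / b ℕ.* b) (m%n<n m b) ⟩
      suc (m / b) ℕ.* b     ≤⟨ ℕP.*-monoˡ-≤ b m/b<X ⟩
      X ℕ.* b               ≡⟨ ℕP.*-comm X b ⟩
      b ℕ.* X               ∎
      where open ℕP.≤-Reasoning

    quotient-<-power : ∀ n N → n < b ^ suc N → n / b < b ^ N
    quotient-<-power n N n<bᴺ⁺¹ = m<n*o⇒m/o<n (subst (n <_) (ℕP.*-comm b (b ^ N)) n<bᴺ⁺¹)

  ndigits-bound : ∀ n → n < b ^ ndigits b n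
  ndigits-bound n = fuel n n ℕP.≤-refl
    where
    fuel : ∀ f m → m ≤ f → m < b ^ ndigitsF f b m
    fuel zero    zero    _         = s≤s z≤n
    fuel (suc f) zero    _         = s≤s z≤n
    fuel (suc f) (suc m) (s≤s m≤f) = quotient-bound (suc m) _ (fuel f (suc m / b) m/b≤f)
      where
      m/b≤f : suc m / b ≤ f
      m/b≤f = ℕP.≤-pred (ℕP.≤-trans (m/n<m (suc m) b (s≤s (s≤s z≤n))) (s≤s m≤f))

  digit-vanish : ∀ l n → n < b ^ l → digit b n l ≡ 0
  digit-vanish zero    zero    _ = refl
  digit-vanish zero    (suc n) (s≤s ())
  digit-vanish (suc l) n n<bˡ = digit-vanish l (n / b) (quotient-<-power n l n<bˡ)

  horner-digits : ∀ N n → n < b ^ N → horner b N (digit b n) ≡ n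
  horner-digits zero    zero    _ = refl
  horner-digits zero    (suc n) (s≤s ())
  horner-digits (suc N) n n<bᴺ =
    trans (cong (λ z → n % b ℕ.+ z ℕ.* b) (horner-digits N (n / b) (quotient-<-power n N n<bᴺ)))
          (sym (m≡m%n+[m/n]*n n b))

  digitFactor : ℕ → ℕ → Series
  digitFactor n l = powS (onePlusX^ (b ^ l)) (digit b n l)

  fpoly-as-prodS : ∀ n N → ndigits b n ≤ N → coeff (fpoly b n) ≗ prodS N (digitFactor n)
  fpoly-as-prodS n N n≤N i =
    trans (trans (coeff-prodPoly (ndigits b n) _ i) (prodS-cong (ndigits b n) coeff-factor i))
          (sym (prodS-pad (ndigits b n) N (digitFactor n) n≤N high-factor-one i))
    where
    coeff-factor : ∀ l → coeff (powP (onePlusXPow (b ^ l)) (digit b n l)) ≗ digitFactor n l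
    coeff-factor l j = trans (coeff-powP _ (digit b n l) j) (powS-cong (coeff-onePlusXPow (b ^ l)) (digit b n l) j)
    high-factor-one : ∀ l → ndigits b n ≤ l → digitFactor n l ≗ δ
    high-factor-one l n≤l j =
      cong (λ e → powS (onePlusX^ (b ^ l)) e j)
           (digit-vanish l n (ℕP.<-≤-trans (ndigits-bound n) (ℕP.^-monoʳ-≤ b n≤l)))

  fpoly-constant : ∀ n → coeff (fpoly b n) 0 ≡ + 1
  fpoly-constant n =
    trans (fpoly-as-prodS n (ndigits b n) ℕP.≤-refl 0)
          (prodS-constant (ndigits b n) (digitFactor n) (λ l → powS-constant _ (onePlus l) (digit b n l)))
    where
    onePlus : ∀ l → onePlusX^ (b ^ l) 0 ≡ + 1
    onePlus l with b ^ l | ℕP.m^n>0 b l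
    ... | suc e | _ = refl

  invCoeff-fpoly : ∀ n N → ndigits b n ≤ N →
                   invCoeff (fpoly b n) ≗ stretchedProduct N (λ l → negBinomialSeries (digit b n l))
  invCoeff-fpoly n N n≤N =
    inverse-unique (coeff (fpoly b n)) _ _ (invCoeff-inverse (fpoly b n) (fpoly-constant n))
      (λ i → trans (⊛-cong factorization (λ _ → refl) i)
                   (stretchedProduct-inverse N _ _ (λ l → binomial-inverse (digit b n l)) i))
    where
    factorization : coeff (fpoly b n) ≗ stretchedProduct N (λ l → binomialSeries (digit b n l))
    factorization j = trans (fpoly-as-prodS n N n≤N j) (prodS-as-stretchedProduct N (digit b n) j)

  fpoly-palindromic : ∀ n → Palindromic n (coeff (fpoly b n))
  fpoly-palindromic n =
    palindromic-cong (λ i → sym (fpoly-as-prodS n L ℕP.≤-refl i))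
      (subst (λ k → Palindromic k (prodS L (digitFactor n))) (horner-digits L n (ndigits-bound n))
             (palindromic-prodS b (s≤s z≤n) L (digit b n)))
    where
    L : ℕ
    L = ndigits b n

  expansion-nonnegative : ∀ n N j → ndigits b n ≤ N →
    invCoeff (fpoly b n) j ≡ sumOver (Ptuples b N j) (tupleProduct N (λ l → negBinomialSeries (digit b n l)))
  expansion-nonnegative n N j n≤N = trans (invCoeff-fpoly n N n≤N j) (sym (Ptuples-stretchedProduct N j _))

  -- k < 0: by palindromy the coefficient of x^{-(t+1)} is that of x^{t+1} in
  -- x^n / f_{n,b} = Π_l (x^{n_l} (1+x)^{-n_l})(x^{b^l}).
  expansion-negative : ∀ n N t → ndigits b n ≤ N →
    expandNeg (fpoly b n) -[1+ t ]
      ≡ sumOver (Ptuples b N (suc t)) (tupleProduct N (λ l → shift (digit b n l) (negBinomialSeries (digit b n l))))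
  expansion-negative n N t n≤N =
    begin
      expandNeg (fpoly b n) -[1+ t ]
    ≡⟨ expandNeg-palindromic (fpoly b n) n (fpoly-palindromic n) t ⟩
      shift n (invCoeff (fpoly b n)) (suc t)
    ≡⟨ shift-cong n (invCoeff-fpoly n N n≤N) (suc t) ⟩
      shift n (stretchedProduct N c) (suc t)
    ≡⟨ cong (λ e → shift e (stretchedProduct N c) (suc t)) (sym (horner-digits N n n<bᴺ)) ⟩
      shift (horner b N (digit b n)) (stretchedProduct N c) (suc t)
    ≡⟨ sym (stretchedProduct-shift N (digit b n) c (suc t)) ⟩
      stretchedProduct N (λ l → shift (digit b n l) (c l)) (suc t)
    ≡⟨ sym (Ptuples-stretchedProduct N (suc t) _) ⟩
      sumOver (Ptuples b N (suc t)) (tupleProduct N (λ l → shift (digit b n l) (c l)))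
    ∎
    where
    open ≡-Reasoning
    c : ℕ → Series
    c l = negBinomialSeries (digit b n l)
    n<bᴺ : n < b ^ N
    n<bᴺ = ℕP.<-≤-trans (ndigits-bound n) (ℕP.^-monoʳ-≤ b n≤N)

proposition2p3 : (b : ℕ) → 2 ≤ b → (n : ℕ) → 0 < n → (k : ℤ) →
    let N = ndigits b n ⊔ ndigits b ∣ k ∣ in
    ((j : ℕ) → k ≡ + j →
      bbinom b (- (+ n)) k ≡
        sumOver (Ptuples b N j) (λ v → prodFinℤ N (λ l → binomZ (- (+ digit b n (toℕ l))) (+ lookup v l))))
    × ((j : ℕ) → 0 < j → k ≡ - (+ j) →
      bbinom b (- (+ n)) k ≡
        sumOver (Pstar b n N j) (λ v → prodFinℤ N (λ l → binomZ (- (+ digit b n (toℕ l))) (- (+ lookup v l)))))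
proposition2p3 zero          ()       n        _  k
proposition2p3 (suc zero)    (s≤s ()) n        _  k
proposition2p3 (suc (suc d)) _        zero     () k
proposition2p3 (suc (suc d)) _        (suc n′) _  k = nonnegative , negative
  where
  open Digits d
  n N : ℕ
  n = suc n′
  N = ndigits b n ⊔ ndigits b ∣ k ∣
  enough-digits : ndigits b n ≤ N
  enough-digits = ℕP.m≤m⊔n (ndigits b n) (ndigits b ∣ k ∣)

  nonnegative : (j : ℕ) → k ≡ + j →
    bbinom b (- (+ n)) k ≡ sumOver (Ptuples b N j) (tupleProduct N (λ l → negBinomialSeries (digit b n l)))
  nonnegative j refl = expansion-nonnegative n N j enough-digits

  negative : (j : ℕ) → 0 < j → k ≡ - (+ j) →
    bbinom b (- (+ n)) k ≡
      sumOver (Pstar b n N j) (λ v → prodFinℤ N (λ l → binomZ (- (+ digit b n (toℕ l))) (- (+ lookup v l))))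
  negative (suc t) _ refl = trans (expansion-negative n N t enough-digits) (sym (Pstar-as-Ptuples b n N (suc t)))
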